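{- Let $G$ be a finite group and let $H$ be a subgroup of $G$. Then the following are equivalent: (a) $H$ is a perfect code of $G$; (b) there exists an inverse-closed right transversal of $H$ in $G$; (c) for each $x\in G$ such that $x^2\in H$ and $|H|/|H\cap H^x|$ is odd, there exists $y\in Hx$ such that $y^2=e$; (d) for each $x\in G$ such that $HxH=Hx^{ -1}H$ and $|H|/|H\cap H^x|$ is odd, there exists $y\in Hx$ such that $y^2=e$.
   Context: All groups and graphs are finite; graphs are undirected and simple. $e$ denotes the identity element, and $H^x=x^{ -1}Hx$. For a group $G$ and an inverse-closed subset $S\subseteq G\setminus\{e\}$, the Cayley graph $\mathrm{Cay}(G,S)$ has vertex set $G$, with $x,y$ adjacent iff $yx^{ -1}\in S$. A subset $C$ of the vertex set of a graph $\Gamma$ is a perfect code in $\Gamma$ if every vertex of $\Gamma$ is at distance at most $1$ from exactly one vertex of $C$. A subset $C$ of a group $G$ is a perfect code of $G$ if $C$ is a perfect code in some Cayley graph of $G$. A right transversal of $H$ in $G$ is a set containing exactly one element of each right coset $Hx$; it is inverse-closed if it contains the inverse of each of its elements. -}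

module Defs where

open import Level using (0ℓ)
open import Data.Nat using (ℕ; _*_; _%_)
open import Data.Fin using (Fin)
open import Data.List using (List; length; map; filter)
open import Data.List.Base using (allFin)
open import Data.Product using (Σ; ∃; ∃-syntax; _×_; _,_)
open import Data.Empty using (⊥)
open import Relation.Nullary using (¬_)
open import Relation.Unary using (Pred; Decidable)
open import Relation.Binary.PropositionalEquality using (_≡_)
open import Algebra.Structures using (IsGroup)
open import Function.Bundles using (_↔_; Inverse)

record FinGroup : Set₁ where
  infixl 7 _∙_
  field
    Carrier : Set
    _∙_     : Carrier → Carrier → Carrier
    e       : Carrier
    _⁻¹     : Carrier → Carrier
    isGroup : IsGroup _≡_ _∙_ e _⁻¹
    size    : ℕ
    enum    : Fin size ↔ Carrier

  elements : List Carrier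
  elements = map (Inverse.to enum) (allFin size)

  card : (P : Pred Carrier 0ℓ) → Decidable P → ℕ
  card P P? = length (filter P? elements)

record Subgroup (G : FinGroup) : Set₁ where
  open FinGroup G
  field
    _∈H    : Pred Carrier 0ℓ
    _∈H?   : Decidable _∈H
    e∈H    : e ∈H
    ∙-closed : ∀ {x y} → x ∈H → y ∈H → (x ∙ y) ∈H
    ⁻¹-closed : ∀ {x} → x ∈H → (x ⁻¹) ∈H

record Graph : Set₁ where
  field
    V       : Set
    Adj     : V → V → Set
    sym     : ∀ {u v} → Adj u v → Adj v u
    irrefl  : ∀ {u} → ¬ Adj u u

module _ (Γ : Graph) where
  open Graph Γ

  Close : V → V → Set
  Close u v = (u ≡ v) ⊎' Adj u v
    where
    open import Data.Sum using () renaming (_⊎_ to _⊎'_)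

  IsPerfectCodeIn : Pred V 0ℓ → Set
  IsPerfectCodeIn C =
    ∀ v → (∃[ c ] (C c × Close v c))
        × (∀ c c' → C c → Close v c → C c' → Close v c' → c ≡ c')

module _ (G : FinGroup) where
  open FinGroup G

  record ConnSet (S : Pred Carrier 0ℓ) : Set where
    field
      e∉S : ¬ S e
      inv-closed : ∀ {s} → S s → S (s ⁻¹)

  Cay : (S : Pred Carrier 0ℓ) → ConnSet S → Graph
  Cay S cs = record
    { V = Carrier
    ; Adj = λ x y → S (y ∙ x ⁻¹)
    ; sym = λ {u} {v} s → subst S (inv-prod v u) (ConnSet.inv-closed cs s)
    ; irrefl = λ {u} s → ConnSet.e∉S cs (subst S (inverseʳ u) s)
    }
    where
    open import Relation.Binary.PropositionalEquality using (subst; cong; sym; trans)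
    open IsGroup isGroup using (inverseʳ)
    open import Algebra.Bundles using (Group)
    grp : Group 0ℓ 0ℓ
    grp = record { isGroup = isGroup }
    open import Algebra.Properties.Group grp using (⁻¹-anti-homo-∙; ⁻¹-involutive)
    inv-prod : ∀ v u → (v ∙ u ⁻¹) ⁻¹ ≡ u ∙ v ⁻¹
    inv-prod v u = trans (⁻¹-anti-homo-∙ v (u ⁻¹)) (cong (_∙ (v ⁻¹)) (⁻¹-involutive u))

  IsPerfectCodeOf : Pred Carrier 0ℓ → Set₁
  IsPerfectCodeOf C = ∃[ S ] Σ (ConnSet S) λ cs → IsPerfectCodeIn (Cay S cs) C

  module _ (H : Subgroup G) where
    open Subgroup H

    _∈H·_ : Carrier → Carrier → Set
    y ∈H· x = ∃[ h ] (h ∈H × y ≡ h ∙ x)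

    IsRightTransversal : Pred Carrier 0ℓ → Set
    IsRightTransversal T =
      ∀ x → (∃[ t ] (T t × t ∈H· x))
          × (∀ t t' → T t → t ∈H· x → T t' → t' ∈H· x → t ≡ t')

    IsInverseClosed : Pred Carrier 0ℓ → Set
    IsInverseClosed T = ∀ {t} → T t → T (t ⁻¹)

    -- H ∩ H^x, where H^x = x⁻¹ H x, i.e. g ∈ H^x iff x g x⁻¹ ∈ H
    H∩Hˣ : Carrier → Pred Carrier 0ℓ
    H∩Hˣ x g = g ∈H × (x ∙ g ∙ x ⁻¹) ∈H

    H∩Hˣ? : (x : Carrier) → Decidable (H∩Hˣ x)
    H∩Hˣ? x g = (g ∈H?) ×-dec ((x ∙ g ∙ x ⁻¹) ∈H?)
      where open import Relation.Nullary.Decidable using (_×-dec_)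

    |H| : ℕ
    |H| = card _∈H _∈H?

    |H∩Hˣ| : Carrier → ℕ
    |H∩Hˣ| x = card (H∩Hˣ x) (H∩Hˣ? x)

    IndexOdd : Carrier → Set
    IndexOdd x = ∃[ k ] (|H| ≡ k * |H∩Hˣ| x × k % 2 ≡ 1)

    _∈H_H : Carrier → Carrier → Set
    g ∈H x H = ∃[ h ] ∃[ h' ] (h ∈H × h' ∈H × g ≡ h ∙ x ∙ h')

    CondA : Set₁
    CondA = IsPerfectCodeOf _∈H

    CondB : Set₁
    CondB = ∃[ T ] (IsRightTransversal T × IsInverseClosed T)

    CondC : Set
    CondC = ∀ x → (x ∙ x) ∈H → IndexOdd x → ∃[ y ] (y ∈H· x × y ∙ y ≡ e)

    CondD : Set
    CondD = ∀ x
          → (∀ g → (g ∈H x H → g ∈H (x ⁻¹) H) × (g ∈H (x ⁻¹) H → g ∈H x H))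
          → IndexOdd x → ∃[ y ] (y ∈H· x × y ∙ y ≡ e)

-- (a) ⇔ (b): if T is an inverse-closed right transversal, H is a perfect code in Cay(G, T ∖ H);
-- conversely, if H is a perfect code in Cay(G, S) then {e} ∪ S is such a transversal, its element
-- in Hx being h x for the codeword h at distance ≤ 1 from x⁻¹.
-- (b) ⇒ (c): HxH is a union of |H : H ∩ Hˣ| right cosets, and when x² ∈ H it is closed under
-- inversion, which then permutes the representatives from T in HxH. An odd number of them forces a
-- fixed point q = q⁻¹ in HxH, and a conjugate of q by an element of H is an involution in Hx.
-- (c) ⇒ (d): if HxH = Hx⁻¹H then some b x ∈ Hx has (b x)² ∈ H, and |H ∩ H^(b x)| = |H ∩ Hˣ|.
-- (d) ⇒ (b): T is built greedily. Every left coset inside a double coset D meets every right coset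
-- of D, so while y is uncovered and Hy⁻¹H has an uncovered right coset other than Hy, one can add
-- some g ∈ Hy together with g⁻¹ from that coset. Counting keeps the uncovered parts of D and D⁻¹
-- equally large, so otherwise Hy is the last uncovered coset of a self-inverse D whose other
-- cosets were covered in pairs; then |H : H ∩ Hʸ| is odd and (d) gives an involution to add.
module Submission where

open import Defs
open import Level using (0ℓ)
open import Algebra.Bundles using (Group)
open import Data.Empty using (⊥-elim)
open import Data.Fin.Properties as Fin using ()
open import Data.List using (List; []; _∷_; length; filter; head)
open import Data.List.Membership.Propositional using (_∈_; lose; find)
open import Data.List.Membership.Propositional.Properties using (∈-map⁺; ∈-allFin; ∈-filter⁺; ∈-filter⁻)
open import Data.List.Properties using (filter-accept; filter-reject; filter-none; filter-≐)
open import Data.List.Relation.Unary.All as All using (All; []; _∷_; all?)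
open import Data.List.Relation.Unary.All.Properties using (¬Any⇒All¬)
open import Data.List.Relation.Unary.Any using (here; there; any?; satisfied)
open import Data.List.Relation.Unary.Unique.Propositional using (Unique; _∷_)
open import Data.List.Relation.Unary.Unique.Propositional.Properties using (map⁺; allFin⁺)
open import Data.Maybe using (just; fromMaybe)
open import Data.Nat using (ℕ; zero; suc; _+_; _*_; _%_; _≤_; _<_; z<s; NonZero; ≢-nonZero; ≢-nonZero⁻¹)
open import Data.Nat.DivMod using ([m+kn]%n≡m%n)
open import Data.Nat.Properties
  using (+-suc; +-assoc; +-comm; +-identityʳ; +-cancelʳ-≡; suc-injective; *-identityʳ; *-comm; *-assoc;
         *-cancelʳ-≡; *-cancelˡ-≡; m<m+n; ≤-refl; ≤-trans; ≤-pred; n≮0; module ≤-Reasoning)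
open import Data.Nat.Solver using (module +-*-Solver)
open import Data.Product using (∃; ∃-syntax; _×_; _,_; proj₁; proj₂)
open import Data.Sum using (_⊎_; inj₁; inj₂)
open import Function using (_∘_)
open import Function.Bundles using (Inverse; Equivalence; _⇔_; mk⇔)
import Function.Properties.Equivalence as Equivalence
open import Relation.Binary.Definitions using (DecidableEquality)
open import Relation.Binary.PropositionalEquality
open import Relation.Nullary using (¬_; Dec; yes; no; map′; ¬?)
open import Relation.Nullary.Decidable as Dec using (_×-dec_)
open import Relation.Unary using (Pred; Decidable; _≐_; _∩_; ∁)
open import Relation.Unary.Properties using (_∩?_; ∁?)

module _ {A : Set} where

  ∃-∈-nonempty : ∀ (xs : List A) {n} → length xs ≡ suc n → ∃ (_∈ xs)
  ∃-∈-nonempty (x ∷ _) _ = x , here refl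

  module _ {P Q : Pred A 0ℓ} (P? : Decidable P) (Q? : Decidable Q) where

    length-filter-∩-∖ : ∀ xs →
      length (filter P? xs) ≡ length (filter (P? ∩? Q?) xs) + length (filter (P? ∩? ∁? Q?) xs)
    length-filter-∩-∖ [] = refl
    length-filter-∩-∖ (x ∷ xs) with P? x | Q? x
    ... | yes _ | yes _ = cong suc (length-filter-∩-∖ xs)
    ... | yes _ | no _  = trans (cong suc (length-filter-∩-∖ xs)) (sym (+-suc _ _))
    ... | no _  | yes _ = length-filter-∩-∖ xs
    ... | no _  | no _  = length-filter-∩-∖ xs

  module _ (_≟_ : DecidableEquality A) where

    length-filter-≡ : ∀ {xs t} → Unique xs → t ∈ xs → length (filter (_≟ t) xs) ≡ 1
    length-filter-≡ {x ∷ xs} (x∉xs ∷ _) (here refl) =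
      cong length (trans (filter-accept (_≟ x) refl)
                         (cong (x ∷_) (filter-none (_≟ x) (All.map (λ x≢y y≡x → x≢y (sym y≡x)) x∉xs))))
    length-filter-≡ {x ∷ xs} {t} (x∉xs ∷ u) (there t∈xs) =
      trans (cong length (filter-reject (_≟ t) (All.lookup x∉xs t∈xs))) (length-filter-≡ u t∈xs)

j*2≡j+j : ∀ j → j * 2 ≡ j + j
j*2≡j+j j = trans (*-comm j 2) (cong (j +_) (+-identityʳ j))

even-not-odd : ∀ j → (j + j) % 2 ≢ 1
even-not-odd j j+j%2≡1 with trans (sym ([m+kn]%n≡m%n 0 j 2)) (trans (cong (_% 2) (j*2≡j+j j)) j+j%2≡1)
... | ()

[1+j+j]%2≡1 : ∀ j → suc (j + j) % 2 ≡ 1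
[1+j+j]%2≡1 j = trans (cong (λ n → suc n % 2) (sym (j*2≡j+j j))) ([m+kn]%n≡m%n 1 j 2)

module Cardinality (G : FinGroup) where
  open FinGroup G

  infix 4 _≟_
  _≟_ : DecidableEquality Carrier
  x ≟ y = map′ (λ eq → trans (sym (strictlyInverseˡ x)) (trans (cong to eq) (strictlyInverseˡ y)))
               (cong from) (from x Fin.≟ from y)
    where open Inverse enum

  elements-unique : Unique elements
  elements-unique = map⁺ to-injective (allFin⁺ size)
    where
    open Inverse enum
    to-injective : ∀ {i j} → to i ≡ to j → i ≡ j
    to-injective {i} {j} eq = trans (sym (strictlyInverseʳ i)) (trans (cong from eq) (strictlyInverseʳ j))

  ∈-elements : ∀ x → x ∈ elements
  ∈-elements x = subst (_∈ elements) (strictlyInverseˡ x) (∈-map⁺ to (∈-allFin (from x)))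
    where open Inverse enum

  ∃? : {P : Pred Carrier 0ℓ} → Decidable P → Dec (∃ P)
  ∃? P? = map′ satisfied (λ (x , px) → lose (∈-elements x) px) (any? P? elements)

  module _ {P : Pred Carrier 0ℓ} (P? : Decidable P) where

    card-∩-∖ : {Q : Pred Carrier 0ℓ} (Q? : Decidable Q) →
      card P P? ≡ card _ (P? ∩? Q?) + card _ (P? ∩? ∁? Q?)
    card-∩-∖ Q? = length-filter-∩-∖ P? Q? elements

    card-empty : (∀ x → ¬ P x) → card P P? ≡ 0
    card-empty ¬P = cong length (filter-none P? {elements} (All.tabulate λ {x} _ → ¬P x))

    card≡suc⇒∃ : ∀ {n} → card P P? ≡ suc n → ∃ P
    card≡suc⇒∃ eq with ∃-∈-nonempty (filter P? elements) eq
    ... | x , x∈ = x , proj₂ (∈-filter⁻ P? {xs = elements} x∈)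

  card-cong : {P Q : Pred Carrier 0ℓ} (P? : Decidable P) (Q? : Decidable Q) → P ≐ Q → card P P? ≡ card Q Q?
  card-cong P? Q? P≐Q = cong length (filter-≐ P? Q? P≐Q elements)

  card-singleton : ∀ t → card (_≡ t) (_≟ t) ≡ 1
  card-singleton t = length-filter-≡ _≟_ elements-unique (∈-elements t)

  module _ {P : Pred Carrier 0ℓ} (P? : Decidable P) where

    card-remove : ∀ {t} → P t → card P P? ≡ suc (card _ (P? ∩? ∁? (_≟ t)))
    card-remove {t} pt = begin
      card P P?                              ≡⟨ card-∩-∖ P? (_≟ t) ⟩
      card _ (P? ∩? (_≟ t)) + rest           ≡⟨ cong (_+ rest) (card-cong (P? ∩? (_≟ t)) (_≟ t) (proj₂ , λ { refl → pt , refl })) ⟩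
      card _ (_≟ t) + rest                   ≡⟨ cong (_+ rest) (card-singleton t) ⟩
      suc rest                               ∎
      where
      open ≡-Reasoning
      rest = card _ (P? ∩? ∁? (_≟ t))

    card≡0⇒empty : card P P? ≡ 0 → ∀ x → ¬ P x
    card≡0⇒empty eq x px with trans (sym eq) (card-remove px)
    ... | ()

  module _ (f : Carrier → Carrier) (m : ℕ) where

    card-fibres : {P Q : Pred Carrier 0ℓ} (P? : Decidable P) (Q? : Decidable Q) →
      (∀ {x} → P x → Q (f x)) → (∀ {q} → Q q → card _ (P? ∩? λ x → f x ≟ q) ≡ m) →
      card P P? ≡ card Q Q? * m
    card-fibres P? Q? f-maps fibres = go _ P? Q? f-maps fibres refl
      where
      go : ∀ n {P Q : Pred Carrier 0ℓ} (P? : Decidable P) (Q? : Decidable Q) →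
           (∀ {x} → P x → Q (f x)) → (∀ {q} → Q q → card _ (P? ∩? λ x → f x ≟ q) ≡ m) →
           card Q Q? ≡ n → card P P? ≡ n * m
      go zero P? Q? f-maps fibres eq = card-empty P? λ x px → card≡0⇒empty Q? eq (f x) (f-maps px)
      go (suc n) P? Q? f-maps fibres eq with card≡suc⇒∃ Q? eq
      ... | q , qq = begin
        card _ P?                                                               ≡⟨ card-∩-∖ P? (λ x → f x ≟ q) ⟩
        card _ (P? ∩? λ x → f x ≟ q) + card _ (P? ∩? ∁? λ x → f x ≟ q)           ≡⟨ cong₂ _+_ (fibres qq) rest ⟩
        m + n * m                                                               ∎
        where
        open ≡-Reasoning
        rest = go n (P? ∩? ∁? λ x → f x ≟ q) (Q? ∩? ∁? (_≟ q))
          (λ (px , fx≢q) → f-maps px , fx≢q)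
          (λ {q′} (qq′ , q′≢q) → trans
            (card-cong _ (P? ∩? λ x → f x ≟ q′)
              ((λ ((px , _) , fx≡q′) → px , fx≡q′) ,
               λ (px , fx≡q′) → (px , λ fx≡q → q′≢q (trans (sym fx≡q′) fx≡q)) , fx≡q′))
            (fibres qq′))
          (suc-injective (trans (sym (card-remove Q? qq)) eq))

  card-bijection : {P Q : Pred Carrier 0ℓ} (P? : Decidable P) (Q? : Decidable Q) (f g : Carrier → Carrier) →
    (∀ {x} → P x → Q (f x)) → (∀ {y} → Q y → P (g y)) →
    (∀ {x} → P x → g (f x) ≡ x) → (∀ {y} → Q y → f (g y) ≡ y) →
    card P P? ≡ card Q Q?
  card-bijection {P} {Q} P? Q? f g f-maps g-maps gf fg =
    trans (card-fibres f 1 P? Q? f-maps fibre≡1) (*-identityʳ _)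
    where
    fibre≡1 : ∀ {q} → Q q → card _ (P? ∩? λ x → f x ≟ q) ≡ 1
    fibre≡1 {q} q∈Q = trans
      (card-cong _ (_≟ g q) ((λ (p , fx≡q) → trans (sym (gf p)) (cong g fx≡q)) , λ { refl → g-maps q∈Q , fg q∈Q }))
      (card-singleton (g q))

  module _ (ι : Carrier → Carrier) (ι-involutive : ∀ x → ι (ι x) ≡ x) where

    module _ {P : Pred Carrier 0ℓ} (P? : Decidable P) (ι-maps : ∀ {x} → P x → P (ι x))
             (ι-fixfree : ∀ {x} → P x → ι x ≢ x) {t : Carrier} (pt : P t) where

      Without-orbit : Pred Carrier 0ℓ
      Without-orbit = (P ∩ ∁ (_≡ t)) ∩ ∁ (_≡ ι t)

      without-orbit? : Decidable Without-orbit
      without-orbit? = (P? ∩? ∁? (_≟ t)) ∩? ∁? (_≟ ι t)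

      card-remove-orbit : card P P? ≡ suc (suc (card _ without-orbit?))
      card-remove-orbit = trans (card-remove P? pt) (cong suc (card-remove (P? ∩? ∁? (_≟ t)) (ι-maps pt , ι-fixfree pt)))

      ι-maps-without-orbit : ∀ {x} → Without-orbit x → Without-orbit (ι x)
      ι-maps-without-orbit {x} ((p , x≢t) , x≢ιt) =
        (ι-maps p , λ ιx≡t → x≢ιt (trans (sym (ι-involutive x)) (cong ι ιx≡t))) ,
        λ ιx≡ιt → x≢t (trans (sym (ι-involutive x)) (trans (cong ι ιx≡ιt) (ι-involutive t)))

    card-involution-even : {P : Pred Carrier 0ℓ} (P? : Decidable P) →
      (∀ {x} → P x → P (ι x)) → (∀ {x} → P x → ι x ≢ x) → ∃[ j ] (card P P? ≡ j + j)
    card-involution-even P? ι-maps ι-fixfree = go _ P? ι-maps ι-fixfree refl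
      where
      go : ∀ n {P : Pred Carrier 0ℓ} (P? : Decidable P) → (∀ {x} → P x → P (ι x)) →
           (∀ {x} → P x → ι x ≢ x) → card P P? ≡ n → ∃[ j ] (n ≡ j + j)
      go zero P? ι-maps ι-fixfree eq = 0 , refl
      go (suc zero) P? ι-maps ι-fixfree eq with card≡suc⇒∃ P? eq
      ... | t , pt with trans (sym eq) (card-remove-orbit P? ι-maps ι-fixfree pt)
      ... | ()
      go (suc (suc n)) P? ι-maps ι-fixfree eq with card≡suc⇒∃ P? eq
      ... | t , pt with go n (without-orbit? P? ι-maps ι-fixfree pt)
                          (ι-maps-without-orbit P? ι-maps ι-fixfree pt) (λ ((p , _) , _) → ι-fixfree p)
                          (suc-injective (suc-injective (trans (sym (card-remove-orbit P? ι-maps ι-fixfree pt)) eq)))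
      ... | j , n≡j+j = suc j , cong suc (trans (cong suc n≡j+j) (sym (+-suc j j)))


  involution-fixed-point : {P : Pred Carrier 0ℓ} (P? : Decidable P) (ι : Carrier → Carrier) →
    (∀ x → ι (ι x) ≡ x) → (∀ {x} → P x → P (ι x)) → card P P? % 2 ≡ 1 → ∃[ x ] (P x × ι x ≡ x)
  involution-fixed-point P? ι ι-involutive ι-maps odd with ∃? (P? ∩? λ x → ι x ≟ x)
  ... | yes fixed = fixed
  ... | no fixfree with card-involution-even ι ι-involutive P? ι-maps (λ px ιx≡x → fixfree (_ , px , ιx≡x))
  ...   | j , card≡j+j = ⊥-elim (even-not-odd j (subst (λ n → n % 2 ≡ 1) card≡j+j odd))

  card-<-⊂ : {P Q : Pred Carrier 0ℓ} (P? : Decidable P) (Q? : Decidable Q) →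
    (∀ {x} → Q x → P x) → ∀ {y} → P y → ¬ Q y → card Q Q? < card P P?
  card-<-⊂ P? Q? Q⊆P {y} py ¬qy = begin-strict
    card _ Q?                                   ≡⟨ card-cong Q? (P? ∩? Q?) ((λ qx → Q⊆P qx , qx) , proj₂) ⟩
    card _ (P? ∩? Q?)                           <⟨ m<m+n _ (subst (0 <_) (sym (card-remove (P? ∩? ∁? Q?) (py , ¬qy))) z<s) ⟩
    card _ (P? ∩? Q?) + card _ (P? ∩? ∁? Q?)     ≡⟨ card-∩-∖ P? Q? ⟨
    card _ P?                                   ∎
    where open ≤-Reasoning

module GroupLemmas (G : FinGroup) where
  open FinGroup G

  group : Group 0ℓ 0ℓ
  group = record { isGroup = isGroup }

  open Group group public using (assoc; identityˡ; identityʳ; inverseˡ; inverseʳ; monoid)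
  open import Algebra.Properties.Group group public
    using (⁻¹-involutive; ⁻¹-anti-homo-∙; ε⁻¹≈ε; inverseˡ-unique; inverseʳ-unique; ∙-cancelʳ)
  open import Algebra.Properties.Monoid monoid using (cancelʳ; cancelˡ; cancelᶜ)
  open import Algebra.Solver.Monoid monoid public using (solve; _⊜_; _⊕_)

  ∙⁻¹∙-cancel : ∀ a b → a ∙ b ⁻¹ ∙ b ≡ a
  ∙⁻¹∙-cancel a b = cancelʳ (inverseˡ b) a

  ∙∙⁻¹-cancel : ∀ a b → a ∙ b ∙ b ⁻¹ ≡ a
  ∙∙⁻¹-cancel a b = cancelʳ (inverseʳ b) a

  ⁻¹∙∙-cancel : ∀ a b → a ⁻¹ ∙ (a ∙ b) ≡ b
  ⁻¹∙∙-cancel a b = cancelˡ (inverseˡ a) b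

  ∙⁻¹-∙⁻¹-telescope : ∀ a b c → c ∙ b ⁻¹ ∙ (b ∙ a ⁻¹) ≡ c ∙ a ⁻¹
  ∙⁻¹-∙⁻¹-telescope a b c = cancelᶜ (inverseˡ b) c (a ⁻¹)

  ⁻¹-anti-homo-∙⁻¹ : ∀ a b → (a ∙ b ⁻¹) ⁻¹ ≡ b ∙ a ⁻¹
  ⁻¹-anti-homo-∙⁻¹ a b = trans (⁻¹-anti-homo-∙ a (b ⁻¹)) (cong (_∙ a ⁻¹) (⁻¹-involutive b))

  ∙-∙⁻¹-conjugate : ∀ d h b → d ∙ h ∙ (d ∙ b) ⁻¹ ≡ d ∙ (h ∙ b ⁻¹) ∙ d ⁻¹
  ∙-∙⁻¹-conjugate d h b = begin
    d ∙ h ∙ (d ∙ b) ⁻¹       ≡⟨ cong (d ∙ h ∙_) (⁻¹-anti-homo-∙ d b) ⟩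
    d ∙ h ∙ (b ⁻¹ ∙ d ⁻¹)    ≡⟨ solve 4 (λ d h b′ d′ → (d ⊕ h) ⊕ (b′ ⊕ d′) ⊜ (d ⊕ (h ⊕ b′)) ⊕ d′) refl d h (b ⁻¹) (d ⁻¹) ⟩
    d ∙ (h ∙ b ⁻¹) ∙ d ⁻¹    ∎
    where open ≡-Reasoning

  conjugate-∙ : ∀ b u v → b ∙ u ∙ b ⁻¹ ∙ (b ∙ v ∙ b ⁻¹) ≡ b ∙ (u ∙ v) ∙ b ⁻¹
  conjugate-∙ b u v = begin
    b ∙ u ∙ b ⁻¹ ∙ (b ∙ v ∙ b ⁻¹)     ≡⟨ cong (b ∙ u ∙ b ⁻¹ ∙_) (assoc b v (b ⁻¹)) ⟩
    b ∙ u ∙ b ⁻¹ ∙ (b ∙ (v ∙ b ⁻¹))   ≡⟨ cancelᶜ (inverseˡ b) (b ∙ u) (v ∙ b ⁻¹) ⟩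
    b ∙ u ∙ (v ∙ b ⁻¹)                ≡⟨ solve 4 (λ b u v b′ → (b ⊕ u) ⊕ (v ⊕ b′) ⊜ (b ⊕ (u ⊕ v)) ⊕ b′) refl b u v (b ⁻¹) ⟩
    b ∙ (u ∙ v) ∙ b ⁻¹                ∎
    where open ≡-Reasoning

  conjugate-e : ∀ b → b ∙ e ∙ b ⁻¹ ≡ e
  conjugate-e b = trans (cong (_∙ b ⁻¹) (identityʳ b)) (inverseʳ b)

  unconjugate : ∀ b z → b ⁻¹ ∙ (b ∙ z ∙ b ⁻¹) ∙ b ≡ z
  unconjugate b z = begin
    b ⁻¹ ∙ (b ∙ z ∙ b ⁻¹) ∙ b   ≡⟨ cong (_∙ b) (sym (assoc _ _ _)) ⟩
    b ⁻¹ ∙ (b ∙ z) ∙ b ⁻¹ ∙ b   ≡⟨ ∙⁻¹∙-cancel _ b ⟩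
    b ⁻¹ ∙ (b ∙ z)              ≡⟨ ⁻¹∙∙-cancel b z ⟩
    z                           ∎
    where open ≡-Reasoning

module Cosets (G : FinGroup) (H : Subgroup G) where
  open FinGroup G
  open Subgroup H
  open Cardinality G
  open GroupLemmas G
  open ≡-Reasoning

  ∈H-resp-≡ : ∀ {a b} → a ≡ b → a ∈H → b ∈H
  ∈H-resp-≡ = subst _∈H

  -- a ~ b means Ha = Hb, and d ≈ g means g ∈ HdH.
  infix 4 _~_ _≈_ _~?_ _≈?_

  _~_ : Carrier → Carrier → Set
  a ~ b = (b ∙ a ⁻¹) ∈H

  _~?_ : ∀ a → Decidable (a ~_)
  a ~? b = (b ∙ a ⁻¹) ∈H?

  ~-refl : ∀ {a} → a ~ a
  ~-refl {a} = ∈H-resp-≡ (sym (inverseʳ a)) e∈H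

  ~-sym : ∀ {a b} → a ~ b → b ~ a
  ~-sym {a} {b} a~b = ∈H-resp-≡ (⁻¹-anti-homo-∙⁻¹ b a) (⁻¹-closed a~b)

  ~-trans : ∀ {a b c} → a ~ b → b ~ c → a ~ c
  ~-trans {a} {b} {c} a~b b~c = ∈H-resp-≡ (∙⁻¹-∙⁻¹-telescope a b c) (∙-closed b~c a~b)

  ~-∙ˡ : ∀ {h} a → h ∈H → a ~ h ∙ a
  ~-∙ˡ {h} a h∈H = ∈H-resp-≡ (sym (∙∙⁻¹-cancel h a)) h∈H

  ~⇒∈H· : ∀ {x y} → x ~ y → _∈H·_ G H y x
  ~⇒∈H· {x} {y} x~y = y ∙ x ⁻¹ , x~y , sym (∙⁻¹∙-cancel y x)

  ∈H·⇒~ : ∀ {x y} → _∈H·_ G H y x → x ~ y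
  ∈H·⇒~ {x} (h , h∈H , refl) = ~-∙ˡ x h∈H

  |H|-coset : ∀ a → card (a ~_) (a ~?_) ≡ |H| G H
  |H|-coset a = card-bijection (a ~?_) _∈H? (_∙ a ⁻¹) (_∙ a) (λ a~x → a~x) (~-∙ˡ a)
    (λ {x} _ → ∙⁻¹∙-cancel x a) (λ {h} _ → ∙∙⁻¹-cancel h a)

  _≈_ : Carrier → Carrier → Set
  d ≈ g = _∈H_H G H g d

  ≈-refl : ∀ {d} → d ≈ d
  ≈-refl {d} = e , e , e∈H , e∈H , sym (trans (identityʳ (e ∙ d)) (identityˡ d))

  ≈-trans : ∀ {d g k} → d ≈ g → g ≈ k → d ≈ k
  ≈-trans {d} (a , b , a∈H , b∈H , refl) (a′ , b′ , a′∈H , b′∈H , refl) =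
    a′ ∙ a , b ∙ b′ , ∙-closed a′∈H a∈H , ∙-closed b∈H b′∈H ,
    solve 5 (λ a′ a d b b′ → (a′ ⊕ ((a ⊕ d) ⊕ b)) ⊕ b′ ⊜ ((a′ ⊕ a) ⊕ d) ⊕ (b ⊕ b′)) refl a′ a d b b′

  ≈-sym : ∀ {d g} → d ≈ g → g ≈ d
  ≈-sym {d} (a , b , a∈H , b∈H , refl) = a ⁻¹ , b ⁻¹ , ⁻¹-closed a∈H , ⁻¹-closed b∈H , sym (begin
    a ⁻¹ ∙ (a ∙ d ∙ b) ∙ b ⁻¹   ≡⟨ cong (_∙ b ⁻¹) (solve 4 (λ a′ a d b → a′ ⊕ ((a ⊕ d) ⊕ b) ⊜ (a′ ⊕ (a ⊕ (d ⊕ b)))) refl (a ⁻¹) a d b) ⟩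
    a ⁻¹ ∙ (a ∙ (d ∙ b)) ∙ b ⁻¹ ≡⟨ cong (_∙ b ⁻¹) (⁻¹∙∙-cancel a (d ∙ b)) ⟩
    d ∙ b ∙ b ⁻¹                ≡⟨ ∙∙⁻¹-cancel d b ⟩
    d                           ∎)

  ≈-⁻¹ : ∀ {d g} → d ≈ g → d ⁻¹ ≈ g ⁻¹
  ≈-⁻¹ {d} (a , b , a∈H , b∈H , refl) = b ⁻¹ , a ⁻¹ , ⁻¹-closed b∈H , ⁻¹-closed a∈H , (begin
    (a ∙ d ∙ b) ⁻¹         ≡⟨ ⁻¹-anti-homo-∙ (a ∙ d) b ⟩
    b ⁻¹ ∙ (a ∙ d) ⁻¹      ≡⟨ cong (b ⁻¹ ∙_) (⁻¹-anti-homo-∙ a d) ⟩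
    b ⁻¹ ∙ (d ⁻¹ ∙ a ⁻¹)   ≡⟨ sym (assoc _ _ _) ⟩
    b ⁻¹ ∙ d ⁻¹ ∙ a ⁻¹     ∎)

  ~⇒≈ : ∀ {g g′} → g ~ g′ → g ≈ g′
  ~⇒≈ {g} {g′} g~g′ = g′ ∙ g ⁻¹ , e , g~g′ , e∈H , sym (trans (identityʳ _) (∙⁻¹∙-cancel g′ g))

  ≈-resp-~ : ∀ {d g g′} → d ≈ g → g ~ g′ → d ≈ g′
  ≈-resp-~ d≈g g~g′ = ≈-trans d≈g (~⇒≈ g~g′)

  ≈⇔∃∙~ : ∀ {d g} → d ≈ g ⇔ (∃[ b ] (b ∈H × d ∙ b ~ g))
  ≈⇔∃∙~ {d} {g} = mk⇔ to from
    where
    to : d ≈ g → ∃[ b ] (b ∈H × d ∙ b ~ g)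
    to (a , b , a∈H , b∈H , refl) = b , b∈H , ∈H-resp-≡ (sym (trans (cong (_∙ (d ∙ b) ⁻¹) (assoc a d b)) (∙∙⁻¹-cancel a (d ∙ b)))) a∈H
    from : ∃[ b ] (b ∈H × d ∙ b ~ g) → d ≈ g
    from (b , b∈H , db~g) = g ∙ (d ∙ b) ⁻¹ , b , db~g , b∈H , trans (sym (∙⁻¹∙-cancel g (d ∙ b))) (sym (assoc _ d b))

  _≈?_ : ∀ d → Decidable (d ≈_)
  d ≈? g = Dec.map (Equivalence.sym ≈⇔∃∙~) (∃? λ b → (b ∈H?) ×-dec ((d ∙ b) ~? g))

  ⁻¹≈⇒≈⁻¹ : ∀ {d c} → d ⁻¹ ≈ c → d ≈ c ⁻¹
  ⁻¹≈⇒≈⁻¹ {d} d⁻¹≈c = subst (_≈ _) (⁻¹-involutive d) (≈-⁻¹ d⁻¹≈c)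

  ≈⁻¹⇒⁻¹≈ : ∀ {d c} → d ≈ c ⁻¹ → d ⁻¹ ≈ c
  ≈⁻¹⇒⁻¹≈ {c = c} d≈c⁻¹ = subst (_ ≈_) (⁻¹-involutive c) (≈-⁻¹ d≈c⁻¹)

  #H : ℕ
  #H = |H| G H

  #HdH : Carrier → ℕ
  #HdH d = card (d ≈_) (d ≈?_)

  #H∩Hᵈ : Carrier → ℕ
  #H∩Hᵈ = |H∩Hˣ| G H

  card-H∩Hᵈ-translate : ∀ d {b} → b ∈H → card (λ h → h ∈H × d ∙ b ~ d ∙ h) (λ h → (h ∈H?) ×-dec ((d ∙ b) ~? (d ∙ h))) ≡ #H∩Hᵈ d
  card-H∩Hᵈ-translate d {b} b∈H = card-bijection _ (H∩Hˣ? G H d) (_∙ b ⁻¹) (_∙ b)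
    (λ {h} (h∈H , db~dh) → ∙-closed h∈H (⁻¹-closed b∈H) , ∈H-resp-≡ (∙-∙⁻¹-conjugate d h b) db~dh)
    (λ {k} (k∈H , dkd⁻¹∈H) → ∙-closed k∈H b∈H ,
       ∈H-resp-≡ (sym (trans (∙-∙⁻¹-conjugate d (k ∙ b) b) (cong (λ z → d ∙ z ∙ d ⁻¹) (∙∙⁻¹-cancel k b)))) dkd⁻¹∈H)
    (λ {h} _ → ∙⁻¹∙-cancel h b) (λ {k} _ → ∙∙⁻¹-cancel k b)

  record CosetSelector : Set where
    field
      select      : Carrier → Carrier
      ~-select    : ∀ g → g ~ select g
      select-cong : ∀ {g g′} → g ~ g′ → select g ≡ select g′

    Selected : Pred Carrier 0ℓ
    Selected q = select q ≡ q

    selected? : Decidable Selected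
    selected? q = select q ≟ q

    card-~-closed : {P : Pred Carrier 0ℓ} (P? : Decidable P) → (∀ {g g′} → P g → g ~ g′ → P g′) →
      card P P? ≡ card _ (P? ∩? selected?) * #H
    card-~-closed {P} P? P-closed = card-fibres select #H P? (P? ∩? selected?) maps fibre≡|H|
      where
      maps : ∀ {x} → P x → P (select x) × Selected (select x)
      maps {x} px = P-closed px (~-select x) , sym (select-cong (~-select x))
      fibre≡|H| : ∀ {q} → P q × Selected q → card _ (P? ∩? λ x → select x ≟ q) ≡ #H
      fibre≡|H| {q} (pq , q-selected) = trans
        (card-cong _ (q ~?_)
          ((λ {x} (_ , sx≡q) → ~-sym (subst (x ~_) sx≡q (~-select x))) ,
           λ q~x → P-closed pq q~x , trans (sym (select-cong q~x)) q-selected))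
        (|H|-coset q)

    #cosetsIn : Carrier → ℕ
    #cosetsIn d = card _ ((d ≈?_) ∩? selected?)

    #HdH≡#cosetsIn*#H : ∀ d → #HdH d ≡ #cosetsIn d * #H
    #HdH≡#cosetsIn*#H d = card-~-closed (d ≈?_) ≈-resp-~

    #H≡#cosetsIn*#H∩Hᵈ : ∀ d → #H ≡ #cosetsIn d * #H∩Hᵈ d
    #H≡#cosetsIn*#H∩Hᵈ d = card-fibres (λ h → select (d ∙ h)) (#H∩Hᵈ d) _∈H? ((d ≈?_) ∩? selected?)
      (λ {h} h∈H → ≈-resp-~ (Equivalence.from ≈⇔∃∙~ (h , h∈H , ~-refl)) (~-select (d ∙ h)) , sym (select-cong (~-select (d ∙ h))))
      fibre
      where
      fibre : ∀ {q} → d ≈ q × Selected q → card _ (_∈H? ∩? λ h → select (d ∙ h) ≟ q) ≡ #H∩Hᵈ d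
      fibre {q} (d≈q , q-selected) with Equivalence.to ≈⇔∃∙~ d≈q
      ... | b , b∈H , db~q = trans
        (card-cong _ _
          ((λ {h} (h∈H , sdh≡q) → h∈H , ~-trans db~q (~-sym (subst (d ∙ h ~_) sdh≡q (~-select (d ∙ h))))) ,
           λ (h∈H , db~dh) → h∈H , trans (sym (select-cong (~-trans (~-sym db~q) db~dh))) q-selected))
        (card-H∩Hᵈ-translate d b∈H)

  canonicalSelector : CosetSelector
  canonicalSelector = record { select = select ; ~-select = ~-select ; select-cong = select-cong }
    where
    -- The fallback e is never used; it does not depend on g, so select-cong follows from filter-≐.
    select : Carrier → Carrier
    select g = fromMaybe e (head (filter (g ~?_) elements))

    head-∈ : ∀ {x : Carrier} {xs} → x ∈ xs → ∃[ y ] (head xs ≡ just y × y ∈ xs)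
    head-∈ {xs = y ∷ _} _ = y , refl , here refl

    ~-select : ∀ g → g ~ select g
    ~-select g with head-∈ (∈-filter⁺ (g ~?_) (∈-elements g) ~-refl)
    ... | y , head≡y , y∈ = subst (g ~_) (sym (cong (fromMaybe e) head≡y)) (proj₂ (∈-filter⁻ (g ~?_) {xs = elements} y∈))

    select-cong : ∀ {g g′} → g ~ g′ → select g ≡ select g′
    select-cong g~g′ = cong (fromMaybe e ∘ head)
      (filter-≐ (_ ~?_) (_ ~?_) (~-trans (~-sym g~g′) , ~-trans g~g′) elements)

  #HdH*#H∩Hᵈ≡#H*#H : ∀ d → #HdH d * #H∩Hᵈ d ≡ #H * #H
  #HdH*#H∩Hᵈ≡#H*#H d = begin
    #HdH d * #H∩Hᵈ d             ≡⟨ cong (_* #H∩Hᵈ d) (#HdH≡#cosetsIn*#H d) ⟩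
    #cosetsIn d * #H * #H∩Hᵈ d   ≡⟨ cong (_* #H∩Hᵈ d) (*-comm (#cosetsIn d) #H) ⟩
    #H * #cosetsIn d * #H∩Hᵈ d   ≡⟨ *-assoc #H (#cosetsIn d) (#H∩Hᵈ d) ⟩
    #H * (#cosetsIn d * #H∩Hᵈ d) ≡⟨ cong (#H *_) (sym (#H≡#cosetsIn*#H∩Hᵈ d)) ⟩
    #H * #H                      ∎
    where open CosetSelector canonicalSelector

  #H-nonZero : NonZero #H
  #H-nonZero = ≢-nonZero λ #H≡0 → card≡0⇒empty _∈H? #H≡0 e e∈H

  #H∩Hᵈ-nonZero : ∀ d → NonZero (#H∩Hᵈ d)
  #H∩Hᵈ-nonZero d = ≢-nonZero λ #K≡0 → card≡0⇒empty (H∩Hˣ? G H d) #K≡0 e (e∈H , ∈H-resp-≡ (sym (conjugate-e d)) e∈H)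

  ≈-inverse-if-square∈H : ∀ {x} → (x ∙ x) ∈H → x ≈ x ⁻¹
  ≈-inverse-if-square∈H {x} xx∈H = (x ∙ x) ⁻¹ , e , ⁻¹-closed xx∈H , e∈H , sym (begin
    (x ∙ x) ⁻¹ ∙ x ∙ e    ≡⟨ identityʳ _ ⟩
    (x ∙ x) ⁻¹ ∙ x        ≡⟨ cong (_∙ x) (⁻¹-anti-homo-∙ x x) ⟩
    x ⁻¹ ∙ x ⁻¹ ∙ x       ≡⟨ ∙⁻¹∙-cancel (x ⁻¹) x ⟩
    x ⁻¹                  ∎)

  ∈Hx-square∈H-if-≈-inverse : ∀ {x} → x ≈ x ⁻¹ → ∃[ b ] (b ∈H × (b ∙ x ∙ (b ∙ x)) ∈H)
  ∈Hx-square∈H-if-≈-inverse {x} (a , b , a∈H , b∈H , x⁻¹≡axb) = b , b∈H , ∈H-resp-≡ (sym bxbx≡ba⁻¹) (∙-closed b∈H (⁻¹-closed a∈H))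
    where
    xb≡a⁻¹x⁻¹ : x ∙ b ≡ a ⁻¹ ∙ x ⁻¹
    xb≡a⁻¹x⁻¹ = sym (begin
      a ⁻¹ ∙ x ⁻¹         ≡⟨ cong (a ⁻¹ ∙_) x⁻¹≡axb ⟩
      a ⁻¹ ∙ (a ∙ x ∙ b)  ≡⟨ cong (a ⁻¹ ∙_) (assoc a x b) ⟩
      a ⁻¹ ∙ (a ∙ (x ∙ b)) ≡⟨ ⁻¹∙∙-cancel a (x ∙ b) ⟩
      x ∙ b               ∎)
    bxbx≡ba⁻¹ : b ∙ x ∙ (b ∙ x) ≡ b ∙ a ⁻¹
    bxbx≡ba⁻¹ = begin
      b ∙ x ∙ (b ∙ x)        ≡⟨ solve 3 (λ b x b′ → (b ⊕ x) ⊕ (b′ ⊕ x) ⊜ (b ⊕ (x ⊕ b′)) ⊕ x) refl b x b ⟩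
      b ∙ (x ∙ b) ∙ x        ≡⟨ cong (λ z → b ∙ z ∙ x) xb≡a⁻¹x⁻¹ ⟩
      b ∙ (a ⁻¹ ∙ x ⁻¹) ∙ x  ≡⟨ cong (_∙ x) (sym (assoc b (a ⁻¹) (x ⁻¹))) ⟩
      b ∙ a ⁻¹ ∙ x ⁻¹ ∙ x    ≡⟨ ∙⁻¹∙-cancel _ x ⟩
      b ∙ a ⁻¹               ∎

  involution-in-coset-if-≈ : ∀ {x q} → x ≈ q → q ∙ q ≡ e → ∃[ y ] (_∈H·_ G H y x × y ∙ y ≡ e)
  involution-in-coset-if-≈ {x} (a , b , a∈H , b∈H , refl) qq≡e =
    b ∙ q ∙ b ⁻¹ , (b ∙ a , ∙-closed b∈H a∈H , bqb⁻¹≡bax) ,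
    trans (conjugate-∙ b q q) (trans (cong (λ z → b ∙ z ∙ b ⁻¹) qq≡e) (conjugate-e b))
    where
    q = a ∙ x ∙ b
    bqb⁻¹≡bax : b ∙ q ∙ b ⁻¹ ≡ b ∙ a ∙ x
    bqb⁻¹≡bax = trans (cong (_∙ b ⁻¹) (solve 4 (λ b a x b′ → b ⊕ ((a ⊕ x) ⊕ b′) ⊜ ((b ⊕ a) ⊕ x) ⊕ b′) refl b a x b))
                      (∙∙⁻¹-cancel (b ∙ a ∙ x) b)

  #H∩Hᵈ-∙ˡ : ∀ {b x} → b ∈H → #H∩Hᵈ (b ∙ x) ≡ #H∩Hᵈ x
  #H∩Hᵈ-∙ˡ {b} {x} b∈H = card-cong (H∩Hˣ? G H (b ∙ x)) (H∩Hˣ? G H x)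
    ((λ {k} (k∈H , bxk[bx]⁻¹∈H) → k∈H , ∈H-resp-≡ (unconjugate b (x ∙ k ∙ x ⁻¹))
       (∙-closed (∙-closed (⁻¹-closed b∈H) (∈H-resp-≡ (conjugate k) bxk[bx]⁻¹∈H)) b∈H)) ,
     (λ {k} (k∈H , xkx⁻¹∈H) → k∈H , ∈H-resp-≡ (sym (conjugate k)) (∙-closed (∙-closed b∈H xkx⁻¹∈H) (⁻¹-closed b∈H))))
    where
    conjugate : ∀ k → b ∙ x ∙ k ∙ (b ∙ x) ⁻¹ ≡ b ∙ (x ∙ k ∙ x ⁻¹) ∙ b ⁻¹
    conjugate k = trans (cong (λ z → z ∙ (b ∙ x) ⁻¹) (assoc b x k)) (∙-∙⁻¹-conjugate b (x ∙ k) x)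

  #HdH-⁻¹ : ∀ d → #HdH d ≡ #HdH (d ⁻¹)
  #HdH-⁻¹ d = card-bijection (d ≈?_) (d ⁻¹ ≈?_) _⁻¹ _⁻¹ ≈-⁻¹ ⁻¹≈⇒≈⁻¹
    (λ {g} _ → ⁻¹-involutive g) (λ {g} _ → ⁻¹-involutive g)

module Conditions (G : FinGroup) (H : Subgroup G) where
  open FinGroup G
  open Subgroup H
  open Cardinality G
  open GroupLemmas G
  open Cosets G H
  open ≡-Reasoning

  CondA⇒CondB : CondA G H → CondB G H
  CondA⇒CondB (S , S-conn , S-perfect) = T , T-transversal , T-inverse-closed
    where
    T : Pred Carrier 0ℓ
    T t = t ≡ e ⊎ S t

    T-inverse-closed : IsInverseClosed G H T
    T-inverse-closed (inj₁ refl) = inj₁ ε⁻¹≈ε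
    T-inverse-closed (inj₂ s)    = inj₂ (ConnSet.inv-closed S-conn s)

    ∙⁻¹⁻¹ : ∀ {h x} → h ∙ x ⁻¹ ⁻¹ ≡ h ∙ x
    ∙⁻¹⁻¹ {h} {x} = cong (h ∙_) (⁻¹-involutive x)

    T-transversal : IsRightTransversal G H T
    T-transversal x = existence , uniqueness
      where
      existence : ∃[ t ] (T t × _∈H·_ G H t x)
      existence with proj₁ (S-perfect (x ⁻¹))
      ... | c , c∈H , inj₁ x⁻¹≡c = e , inj₁ refl , x ⁻¹ , subst _∈H (sym x⁻¹≡c) c∈H , sym (inverseˡ x)
      ... | c , c∈H , inj₂ adj   = c ∙ x , inj₂ (subst S ∙⁻¹⁻¹ adj) , c , c∈H , refl

      codeword-near-x⁻¹ : ∀ {t h} → T t → t ≡ h ∙ x → Close (Cay G S S-conn) (x ⁻¹) h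
      codeword-near-x⁻¹ {h = h} (inj₁ refl) e≡hx = inj₁ (sym (inverseˡ-unique h x (sym e≡hx)))
      codeword-near-x⁻¹ (inj₂ s) refl = inj₂ (subst S (sym ∙⁻¹⁻¹) s)

      uniqueness : ∀ t t′ → T t → _∈H·_ G H t x → T t′ → _∈H·_ G H t′ x → t ≡ t′
      uniqueness t t′ t∈T (h , h∈H , t≡hx) t′∈T (h′ , h′∈H , t′≡h′x) = begin
        t      ≡⟨ t≡hx ⟩
        h ∙ x  ≡⟨ cong (_∙ x) (proj₂ (S-perfect (x ⁻¹)) h h′ h∈H (codeword-near-x⁻¹ t∈T t≡hx) h′∈H (codeword-near-x⁻¹ t′∈T t′≡h′x)) ⟩
        h′ ∙ x ≡⟨ sym t′≡h′x ⟩
        t′     ∎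

  CondB⇒CondA : CondB G H → CondA G H
  CondB⇒CondA (T , T-transversal , T-inverse-closed) = S , S-conn , H-perfect
    where
    S : Pred Carrier 0ℓ
    S g = T g × ¬ g ∈H

    S-conn : ConnSet G S
    S-conn = record
      { e∉S        = λ (_ , e∉H) → e∉H e∈H
      ; inv-closed = λ (t , t∉H) → T-inverse-closed t , λ t⁻¹∈H → t∉H (∈H-resp-≡ (⁻¹-involutive _) (⁻¹-closed t⁻¹∈H))
      }

    H-perfect : IsPerfectCodeIn (Cay G S S-conn) _∈H
    H-perfect v = existence , uniqueness
      where
      existence : ∃[ c ] (c ∈H × Close (Cay G S S-conn) v c)
      existence with v ∈H?
      ... | yes v∈H = v , v∈H , inj₁ refl
      ... | no v∉H with proj₁ (T-transversal (v ⁻¹))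
      ... | t , t∈T , h , h∈H , t≡hv⁻¹ = h , h∈H , inj₂ (subst T t≡hv⁻¹ t∈T , hv⁻¹∉H)
        where
        hv⁻¹∉H : ¬ (h ∙ v ⁻¹) ∈H
        hv⁻¹∉H hv⁻¹∈H = v∉H (∈H-resp-≡ (⁻¹-involutive v)
          (⁻¹-closed (∈H-resp-≡ (⁻¹∙∙-cancel h (v ⁻¹)) (∙-closed (⁻¹-closed h∈H) hv⁻¹∈H))))

      uniqueness : ∀ c c′ → c ∈H → Close (Cay G S S-conn) v c → c′ ∈H → Close (Cay G S S-conn) v c′ → c ≡ c′
      uniqueness c c′ _ (inj₁ refl) _ (inj₁ refl) = refl
      uniqueness c c′ c∈H (inj₁ refl) c′∈H (inj₂ (_ , c′c⁻¹∉H)) = ⊥-elim (c′c⁻¹∉H (∙-closed c′∈H (⁻¹-closed c∈H)))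
      uniqueness c c′ c∈H (inj₂ (_ , cc′⁻¹∉H)) c′∈H (inj₁ refl) = ⊥-elim (cc′⁻¹∉H (∙-closed c∈H (⁻¹-closed c′∈H)))
      uniqueness c c′ c∈H (inj₂ (cv⁻¹∈T , _)) c′∈H (inj₂ (c′v⁻¹∈T , _)) =
        ∙-cancelʳ (v ⁻¹) c c′ (proj₂ (T-transversal (v ⁻¹)) _ _ cv⁻¹∈T (c , c∈H , refl) c′v⁻¹∈T (c′ , c′∈H , refl))

  module Transversal {T : Pred Carrier 0ℓ} (T-transversal : IsRightTransversal G H T) where

    rep : Carrier → Carrier
    rep g = proj₁ (proj₁ (T-transversal g))

    rep∈T : ∀ g → T (rep g)
    rep∈T g = proj₁ (proj₂ (proj₁ (T-transversal g)))

    ~-rep : ∀ g → g ~ rep g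
    ~-rep g = ∈H·⇒~ (proj₂ (proj₂ (proj₁ (T-transversal g))))

    T-unique : ∀ {g t t′} → T t → g ~ t → T t′ → g ~ t′ → t ≡ t′
    T-unique {g} t∈T g~t t′∈T g~t′ = proj₂ (T-transversal g) _ _ t∈T (~⇒∈H· g~t) t′∈T (~⇒∈H· g~t′)

    selector : CosetSelector
    selector = record
      { select      = rep
      ; ~-select    = ~-rep
      ; select-cong = λ {g} g~g′ → T-unique (rep∈T g) (~-rep g) (rep∈T _) (~-trans g~g′ (~-rep _))
      }

    open CosetSelector selector public using (Selected; selected?; #cosetsIn; #H≡#cosetsIn*#H∩Hᵈ)

    T⇒Selected : ∀ {t} → T t → Selected t
    T⇒Selected {t} t∈T = T-unique (rep∈T t) (~-rep t) t∈T ~-refl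

    Selected⇒T : ∀ {t} → Selected t → T t
    Selected⇒T {t} t-selected = subst T t-selected (rep∈T t)

  CondB⇒CondC : CondB G H → CondC G H
  CondB⇒CondC (T , T-transversal , T-inverse-closed) x xx∈H (k , #H≡k*#K , k-odd) =
    let q , (x≈q , _) , q⁻¹≡q = involution-fixed-point ((x ≈?_) ∩? selected?) _⁻¹ ⁻¹-involutive ⁻¹-maps #cosetsIn-odd
    in  involution-in-coset-if-≈ x≈q (trans (cong (q ∙_) (sym q⁻¹≡q)) (inverseʳ q))
    where
    open Transversal T-transversal

    ⁻¹-maps : ∀ {q} → x ≈ q × Selected q → x ≈ q ⁻¹ × Selected (q ⁻¹)
    ⁻¹-maps (x≈q , q-selected) =
      ≈-trans (≈-inverse-if-square∈H xx∈H) (≈-⁻¹ x≈q) , T⇒Selected (T-inverse-closed (Selected⇒T q-selected))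

    #cosetsIn≡k : #cosetsIn x ≡ k
    #cosetsIn≡k = *-cancelʳ-≡ (#cosetsIn x) k (#H∩Hᵈ x) {{#H∩Hᵈ-nonZero x}}
                    (trans (sym (#H≡#cosetsIn*#H∩Hᵈ x)) #H≡k*#K)

    #cosetsIn-odd : #cosetsIn x % 2 ≡ 1
    #cosetsIn-odd = subst (λ n → n % 2 ≡ 1) (sym #cosetsIn≡k) k-odd

  CondC⇒CondD : CondC G H → CondD G H
  CondC⇒CondD condC x HxH≡Hx⁻¹H (k , #H≡k*#K , k-odd)
    with ∈Hx-square∈H-if-≈-inverse (proj₂ (HxH≡Hx⁻¹H (x ⁻¹)) ≈-refl)
  ... | b , b∈H , bxbx∈H with condC (b ∙ x) bxbx∈H (k , trans #H≡k*#K (cong (k *_) (sym (#H∩Hᵈ-∙ˡ b∈H))) , k-odd)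
  ... | y , (h , h∈H , y≡hbx) , yy≡e = y , (h ∙ b , ∙-closed h∈H b∈H , trans y≡hbx (sym (assoc h b x))) , yy≡e

module GreedyTransversal (G : FinGroup) (H : Subgroup G) where
  open FinGroup G
  open Subgroup H
  open Cardinality G
  open GroupLemmas G hiding (solve; _⊜_; _⊕_)
  open Cosets G H
  open ≡-Reasoning

  Uncovered : List Carrier → Pred Carrier 0ℓ
  Uncovered T g = All (λ t → ¬ g ~ t) T

  uncovered? : ∀ T → Decidable (Uncovered T)
  uncovered? T g = all? (λ t → ¬? (g ~? t)) T

  Uncovered-resp-~ : ∀ {T g g′} → Uncovered T g → g ~ g′ → Uncovered T g′
  Uncovered-resp-~ u g~g′ = All.map (λ g≁t g′~t → g≁t (~-trans g~g′ g′~t)) u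

  #uncovered : List Carrier → Carrier → ℕ
  #uncovered T d = card _ ((d ≈?_) ∩? uncovered? T)

  #H-if : ∀ {A : Set} → Dec A → ℕ
  #H-if (yes _) = #H
  #H-if (no _)  = 0

  #HdH∩Hc : Carrier → Carrier → ℕ
  #HdH∩Hc d c = #H-if (d ≈? c)

  #HdH∩Hc-≈ : ∀ {d c} → d ≈ c → #HdH∩Hc d c ≡ #H
  #HdH∩Hc-≈ {d} {c} d≈c with d ≈? c
  ... | yes _   = refl
  ... | no d≉c  = ⊥-elim (d≉c d≈c)

  #HdH∩Hc-≉ : ∀ {d c} → ¬ d ≈ c → #HdH∩Hc d c ≡ 0
  #HdH∩Hc-≉ {d} {c} d≉c with d ≈? c
  ... | yes d≈c = ⊥-elim (d≉c d≈c)
  ... | no _    = refl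

  #HdH∩Hc-⁻¹ : ∀ d c → #HdH∩Hc (d ⁻¹) c ≡ #HdH∩Hc d (c ⁻¹)
  #HdH∩Hc-⁻¹ d c with d ⁻¹ ≈? c | d ≈? c ⁻¹
  ... | yes _       | yes _       = refl
  ... | yes d⁻¹≈c   | no d≉c⁻¹    = ⊥-elim (d≉c⁻¹ (⁻¹≈⇒≈⁻¹ d⁻¹≈c))
  ... | no d⁻¹≉c    | yes d≈c⁻¹   = ⊥-elim (d⁻¹≉c (≈⁻¹⇒⁻¹≈ d≈c⁻¹))
  ... | no _        | no _        = refl

  #uncovered-∷ : ∀ {T c} d → Uncovered T c → #uncovered (c ∷ T) d + #HdH∩Hc d c ≡ #uncovered T d
  #uncovered-∷ {T} {c} d c-uncovered = begin
    #uncovered (c ∷ T) d + #HdH∩Hc d c                    ≡⟨ +-comm _ (#HdH∩Hc d c) ⟩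
    #HdH∩Hc d c + #uncovered (c ∷ T) d                    ≡⟨ cong₂ _+_ in-Hc outside-Hc ⟨
    card _ (U? ∩? (_~? c)) + card _ (U? ∩? ∁? (_~? c))    ≡⟨ card-∩-∖ U? (_~? c) ⟨
    #uncovered T d                                        ∎
    where
    U? = (d ≈?_) ∩? uncovered? T

    outside-Hc : card _ (U? ∩? ∁? (_~? c)) ≡ #uncovered (c ∷ T) d
    outside-Hc = card-cong _ _
      ((λ ((d≈g , u) , g≁c) → d≈g , g≁c ∷ u) , λ { (d≈g , g≁c ∷ u) → (d≈g , u) , g≁c })

    in-Hc : card _ (U? ∩? (_~? c)) ≡ #HdH∩Hc d c
    in-Hc with d ≈? c
    ... | yes d≈c = trans
      (card-cong _ (c ~?_)
        ((λ (_ , g~c) → ~-sym g~c) ,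
         λ c~g → (≈-resp-~ d≈c c~g , Uncovered-resp-~ c-uncovered c~g) , ~-sym c~g))
      (|H|-coset c)
    ... | no d≉c = card-empty _ (λ g ((d≈g , _) , g~c) → d≉c (≈-resp-~ d≈g g~c))

  -- Outside the fully covered case, the cosets already covered in a self-inverse double coset
  -- come in pairs Ht, Ht⁻¹.
  EvenlyCovered : List Carrier → Carrier → Set
  EvenlyCovered T d = #uncovered T d ≡ 0 ⊎ ∃[ j ] (#HdH d ≡ #uncovered T d + (j + j) * #H)

  DistinctCosets : List Carrier → Set
  DistinctCosets T = ∀ {t t′} → t ∈ T → t′ ∈ T → t ~ t′ → t ≡ t′

  Balanced : List Carrier → Set
  Balanced T = ∀ d → #uncovered T d ≡ #uncovered T (d ⁻¹)

  record PartialTransversal (T : List Carrier) : Set where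
    field
      inverse-closed  : ∀ {t} → t ∈ T → t ⁻¹ ∈ T
      distinct-cosets : DistinctCosets T
      balanced        : Balanced T
      evenly-covered  : ∀ d → d ≈ d ⁻¹ → EvenlyCovered T d

  distinct-cosets-∷ : ∀ {T c} → Uncovered T c → DistinctCosets T → DistinctCosets (c ∷ T)
  distinct-cosets-∷ c-unc distinct (here refl) (here refl) _      = refl
  distinct-cosets-∷ c-unc distinct (here refl) (there t′∈T) c~t′  = ⊥-elim (All.lookup c-unc t′∈T c~t′)
  distinct-cosets-∷ c-unc distinct (there t∈T) (here refl) t~c    = ⊥-elim (All.lookup c-unc t∈T (~-sym t~c))
  distinct-cosets-∷ c-unc distinct (there t∈T) (there t′∈T) t~t′ = distinct t∈T t′∈T t~t′

  balanced-extend : ∀ {T T′} (k : Carrier → ℕ) → (∀ d → #uncovered T′ d + k d ≡ #uncovered T d) →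
    (∀ d → k (d ⁻¹) ≡ k d) → Balanced T → Balanced T′
  balanced-extend {T} {T′} k removed k-⁻¹ balanced d = +-cancelʳ-≡ (k d) _ _ (begin
    #uncovered T′ d + k d             ≡⟨ removed d ⟩
    #uncovered T d                    ≡⟨ balanced d ⟩
    #uncovered T (d ⁻¹)               ≡⟨ removed (d ⁻¹) ⟨
    #uncovered T′ (d ⁻¹) + k (d ⁻¹)   ≡⟨ cong (#uncovered T′ (d ⁻¹) +_) (k-⁻¹ d) ⟩
    #uncovered T′ (d ⁻¹) + k d        ∎)

  EvenlyCovered-≡ : ∀ {T T′ d} → #uncovered T′ d ≡ #uncovered T d → EvenlyCovered T d → EvenlyCovered T′ d
  EvenlyCovered-≡ eq (inj₁ none)          = inj₁ (trans eq none)
  EvenlyCovered-≡ eq (inj₂ (j , #HdH≡))   = inj₂ (j , trans #HdH≡ (cong (_+ (j + j) * #H) (sym eq)))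

  EvenlyCovered-pair : ∀ {T T′ d} → #uncovered T′ d + (#H + #H) ≡ #uncovered T d → #uncovered T d ≢ 0 →
    EvenlyCovered T d → EvenlyCovered T′ d
  EvenlyCovered-pair removed u≢0 (inj₁ u≡0) = ⊥-elim (u≢0 u≡0)
  EvenlyCovered-pair {T} {T′} {d} removed u≢0 (inj₂ (j , #HdH≡)) = inj₂ (suc j , (begin
    #HdH d                                       ≡⟨ #HdH≡ ⟩
    #uncovered T d + (j + j) * #H                ≡⟨ cong (_+ (j + j) * #H) removed ⟨
    #uncovered T′ d + (#H + #H) + (j + j) * #H   ≡⟨ solve 3 (λ u h j → u :+ (h :+ h) :+ (j :+ j) :* h := u :+ ((con 1 :+ j) :+ (con 1 :+ j)) :* h) refl (#uncovered T′ d) #H j ⟩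
    #uncovered T′ d + (suc j + suc j) * #H       ∎))
    where open +-*-Solver

  HasPartner : List Carrier → Carrier → Set
  HasPartner T y = ∃[ g ] (y ~ g × Uncovered T (g ⁻¹) × ¬ y ~ g ⁻¹)

  hasPartner? : ∀ T y → Dec (HasPartner T y)
  hasPartner? T y = ∃? λ g → (y ~? g) ×-dec (uncovered? T (g ⁻¹) ×-dec ¬? (y ~? (g ⁻¹)))

  -- The left coset y⁻¹H meets every right coset Hz inside Hy⁻¹H: if z = a y⁻¹ b then (b⁻¹ y)⁻¹ ∈ Hz.
  partner-from-Hy⁻¹H : ∀ {T y z} → y ⁻¹ ≈ z → Uncovered T z → ¬ y ~ z → HasPartner T y
  partner-from-Hy⁻¹H {T} {y} (a , b , a∈H , b∈H , refl) z-unc y≁z =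
    b ⁻¹ ∙ y , ~-∙ˡ y (⁻¹-closed b∈H) , Uncovered-resp-~ z-unc (~-sym g⁻¹~z) , λ y~g⁻¹ → y≁z (~-trans y~g⁻¹ g⁻¹~z)
    where
    g⁻¹≡y⁻¹b : (b ⁻¹ ∙ y) ⁻¹ ≡ y ⁻¹ ∙ b
    g⁻¹≡y⁻¹b = trans (⁻¹-anti-homo-∙ (b ⁻¹) y) (cong (y ⁻¹ ∙_) (⁻¹-involutive b))
    g⁻¹~z : (b ⁻¹ ∙ y) ⁻¹ ~ a ∙ y ⁻¹ ∙ b
    g⁻¹~z = subst ((b ⁻¹ ∙ y) ⁻¹ ~_) (trans (cong (a ∙_) g⁻¹≡y⁻¹b) (sym (assoc a (y ⁻¹) b))) (~-∙ˡ _ a∈H)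

  #allUncovered : List Carrier → ℕ
  #allUncovered T = card (Uncovered T) (uncovered? T)

  Extension : List Carrier → Set
  Extension T = ∃[ T′ ] (PartialTransversal T′ × #allUncovered T′ < #allUncovered T)

  #uncovered-pair : ∀ {T g} → Uncovered (g ⁻¹ ∷ T) g → Uncovered T (g ⁻¹) →
    ∀ d → #uncovered (g ∷ g ⁻¹ ∷ T) d + (#HdH∩Hc d g + #HdH∩Hc d (g ⁻¹)) ≡ #uncovered T d
  #uncovered-pair {T} {g} g-unc g⁻¹-unc d = begin
    #uncovered (g ∷ g ⁻¹ ∷ T) d + (#HdH∩Hc d g + #HdH∩Hc d (g ⁻¹)) ≡⟨ +-assoc (#uncovered (g ∷ g ⁻¹ ∷ T) d) (#HdH∩Hc d g) (#HdH∩Hc d (g ⁻¹)) ⟨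
    #uncovered (g ∷ g ⁻¹ ∷ T) d + #HdH∩Hc d g + #HdH∩Hc d (g ⁻¹)   ≡⟨ cong (_+ #HdH∩Hc d (g ⁻¹)) (#uncovered-∷ d g-unc) ⟩
    #uncovered (g ⁻¹ ∷ T) d + #HdH∩Hc d (g ⁻¹)                      ≡⟨ #uncovered-∷ d g⁻¹-unc ⟩
    #uncovered T d                                                  ∎

  #HdH∩Hc-pair-⁻¹ : ∀ g d → #HdH∩Hc (d ⁻¹) g + #HdH∩Hc (d ⁻¹) (g ⁻¹) ≡ #HdH∩Hc d g + #HdH∩Hc d (g ⁻¹)
  #HdH∩Hc-pair-⁻¹ g d = begin
    #HdH∩Hc (d ⁻¹) g + #HdH∩Hc (d ⁻¹) (g ⁻¹)    ≡⟨ cong₂ _+_ (#HdH∩Hc-⁻¹ d g) (#HdH∩Hc-⁻¹ d (g ⁻¹)) ⟩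
    #HdH∩Hc d (g ⁻¹) + #HdH∩Hc d (g ⁻¹ ⁻¹)      ≡⟨ cong (λ c → #HdH∩Hc d (g ⁻¹) + #HdH∩Hc d c) (⁻¹-involutive g) ⟩
    #HdH∩Hc d (g ⁻¹) + #HdH∩Hc d g              ≡⟨ +-comm (#HdH∩Hc d (g ⁻¹)) (#HdH∩Hc d g) ⟩
    #HdH∩Hc d g + #HdH∩Hc d (g ⁻¹)              ∎

  module _ {T y} (pt : PartialTransversal T) (y-unc : Uncovered T y) where
    open PartialTransversal pt

    extend-by-pair : ∀ {g} → y ~ g → Uncovered T (g ⁻¹) → ¬ y ~ g ⁻¹ → Extension T
    extend-by-pair {g} y~g g⁻¹-unc y≁g⁻¹ = g ∷ g ⁻¹ ∷ T , pt′ ,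
      card-<-⊂ (uncovered? T) (uncovered? (g ∷ g ⁻¹ ∷ T)) (λ { (_ ∷ _ ∷ u) → u }) y-unc (λ { (y≁g ∷ _) → y≁g y~g })
      where
      g-unc : Uncovered (g ⁻¹ ∷ T) g
      g-unc = (λ g~g⁻¹ → y≁g⁻¹ (~-trans y~g g~g⁻¹)) ∷ Uncovered-resp-~ y-unc y~g

      evenly-covered′ : ∀ d → d ≈ d ⁻¹ → EvenlyCovered (g ∷ g ⁻¹ ∷ T) d
      evenly-covered′ d d≈d⁻¹ with d ≈? g
      ... | yes d≈g = EvenlyCovered-pair
        (trans (cong (#uncovered (g ∷ g ⁻¹ ∷ T) d +_) (sym (cong₂ _+_ (#HdH∩Hc-≈ d≈g) (#HdH∩Hc-≈ d≈g⁻¹))))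
               (#uncovered-pair g-unc g⁻¹-unc d))
        (λ u≡0 → card≡0⇒empty _ u≡0 y (≈-resp-~ d≈g (~-sym y~g) , y-unc))
        (evenly-covered d d≈d⁻¹)
        where
        d≈g⁻¹ : d ≈ g ⁻¹
        d≈g⁻¹ = ≈-trans d≈d⁻¹ (≈-⁻¹ d≈g)
      ... | no d≉g = EvenlyCovered-≡
        (trans (sym (+-identityʳ _)) (trans (cong (#uncovered (g ∷ g ⁻¹ ∷ T) d +_)
          (sym (cong₂ _+_ (#HdH∩Hc-≉ d≉g) (#HdH∩Hc-≉ d≉g⁻¹)))) (#uncovered-pair g-unc g⁻¹-unc d)))
        (evenly-covered d d≈d⁻¹)
        where
        d≉g⁻¹ : ¬ d ≈ g ⁻¹
        d≉g⁻¹ d≈g⁻¹ = d≉g (subst (d ≈_) (⁻¹-involutive g) (≈-trans d≈d⁻¹ (≈-⁻¹ d≈g⁻¹)))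

      pt′ : PartialTransversal (g ∷ g ⁻¹ ∷ T)
      pt′ = record
        { inverse-closed  = λ { (here refl) → there (here refl)
                              ; (there (here refl)) → here (⁻¹-involutive g)
                              ; (there (there t∈T)) → there (there (inverse-closed t∈T)) }
        ; distinct-cosets = distinct-cosets-∷ g-unc (distinct-cosets-∷ g⁻¹-unc distinct-cosets)
        ; balanced        = balanced-extend _ (#uncovered-pair g-unc g⁻¹-unc) (#HdH∩Hc-pair-⁻¹ g) balanced
        ; evenly-covered  = evenly-covered′
        }

    ≈-inverse-if-no-partner : ¬ HasPartner T y → y ≈ y ⁻¹
    ≈-inverse-if-no-partner no-partner with y ≈? y ⁻¹
    ... | yes y≈y⁻¹ = y≈y⁻¹
    ... | no y≉y⁻¹ =
      let z , y⁻¹≈z , z-unc = card≡suc⇒∃ _ (trans (sym (balanced y)) (card-remove ((y ≈?_) ∩? uncovered? T) (≈-refl , y-unc)))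
      in  ⊥-elim (no-partner (partner-from-Hy⁻¹H y⁻¹≈z z-unc λ y~z → y≉y⁻¹ (≈-trans (~⇒≈ y~z) (≈-sym y⁻¹≈z))))

    uncovered-in-Hy : ¬ HasPartner T y → ∀ {z} → y ≈ z → Uncovered T z → y ~ z
    uncovered-in-Hy no-partner {z} y≈z z-unc with y ~? z
    ... | yes y~z = y~z
    ... | no y≁z  = ⊥-elim (no-partner (partner-from-Hy⁻¹H y⁻¹≈z z-unc y≁z))
      where
      y⁻¹≈z : y ⁻¹ ≈ z
      y⁻¹≈z = ≈-trans (≈-sym (≈-inverse-if-no-partner no-partner)) y≈z

    extend-by-involution : ¬ HasPartner T y → ∀ {g} → y ~ g → g ∙ g ≡ e → Extension T
    extend-by-involution no-partner {g} y~g gg≡e = g ∷ T , pt′ ,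
      card-<-⊂ (uncovered? T) (uncovered? (g ∷ T)) (λ { (_ ∷ u) → u }) y-unc (λ { (y≁g ∷ _) → y≁g y~g })
      where
      g⁻¹≡g : g ⁻¹ ≡ g
      g⁻¹≡g = sym (inverseʳ-unique g g gg≡e)

      g-unc : Uncovered T g
      g-unc = Uncovered-resp-~ y-unc y~g

      evenly-covered′ : ∀ d → d ≈ d ⁻¹ → EvenlyCovered (g ∷ T) d
      evenly-covered′ d d≈d⁻¹ with d ≈? g
      ... | yes d≈g = inj₁ (card-empty _ λ { z (d≈z , z≁g ∷ z-unc) →
              z≁g (~-trans (~-sym (uncovered-in-Hy no-partner (≈-trans y≈d d≈z) z-unc)) y~g) })
        where
        y≈d : y ≈ d
        y≈d = ≈-sym (≈-resp-~ d≈g (~-sym y~g))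
      ... | no d≉g = EvenlyCovered-≡
        (trans (sym (+-identityʳ _)) (trans (cong (#uncovered (g ∷ T) d +_) (sym (#HdH∩Hc-≉ d≉g))) (#uncovered-∷ d g-unc)))
        (evenly-covered d d≈d⁻¹)

      pt′ : PartialTransversal (g ∷ T)
      pt′ = record
        { inverse-closed  = λ { (here refl) → here g⁻¹≡g ; (there t∈T) → there (inverse-closed t∈T) }
        ; distinct-cosets = distinct-cosets-∷ g-unc distinct-cosets
        ; balanced        = balanced-extend _ (λ d → #uncovered-∷ d g-unc)
                              (λ d → trans (#HdH∩Hc-⁻¹ d g) (cong (#HdH∩Hc d) g⁻¹≡g)) balanced
        ; evenly-covered  = evenly-covered′
        }

    IndexOdd-if-no-partner : ¬ HasPartner T y → IndexOdd G H y
    IndexOdd-if-no-partner no-partner = suc (j + j) , #H≡odd*#H∩Hʸ , [1+j+j]%2≡1 j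
      where
      #uncovered≡#H : #uncovered T y ≡ #H
      #uncovered≡#H = trans
        (card-cong _ (y ~?_)
          ((λ (y≈z , z-unc) → uncovered-in-Hy no-partner y≈z z-unc) ,
           λ y~z → ~⇒≈ y~z , Uncovered-resp-~ y-unc y~z))
        (|H|-coset y)

      odd-multiple : ∃[ j ] (#HdH y ≡ suc (j + j) * #H)
      odd-multiple with evenly-covered y (≈-inverse-if-no-partner no-partner)
      ... | inj₁ u≡0        = ⊥-elim (≢-nonZero⁻¹ #H {{#H-nonZero}} (trans (sym #uncovered≡#H) u≡0))
      ... | inj₂ (j , #HyH≡) = j , trans #HyH≡ (cong (_+ (j + j) * #H) #uncovered≡#H)

      j = proj₁ odd-multiple

      #H≡odd*#H∩Hʸ : #H ≡ suc (j + j) * #H∩Hᵈ y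
      #H≡odd*#H∩Hʸ = sym (*-cancelˡ-≡ _ _ #H {{#H-nonZero}} (begin
        #H * (suc (j + j) * #H∩Hᵈ y)   ≡⟨ *-assoc #H (suc (j + j)) (#H∩Hᵈ y) ⟨
        #H * suc (j + j) * #H∩Hᵈ y     ≡⟨ cong (_* #H∩Hᵈ y) (*-comm #H (suc (j + j))) ⟩
        suc (j + j) * #H * #H∩Hᵈ y     ≡⟨ cong (_* #H∩Hᵈ y) (proj₂ odd-multiple) ⟨
        #HdH y * #H∩Hᵈ y               ≡⟨ #HdH*#H∩Hᵈ≡#H*#H y ⟩
        #H * #H                        ∎))

    extend : CondD G H → Extension T
    extend condD with hasPartner? T y
    ... | yes (g , y~g , g⁻¹-unc , y≁g⁻¹) = extend-by-pair y~g g⁻¹-unc y≁g⁻¹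
    ... | no no-partner =
      let y′ , y′∈Hy , y′y′≡e = condD y (λ g → ≈-trans (≈-sym y≈y⁻¹) , ≈-trans y≈y⁻¹) (IndexOdd-if-no-partner no-partner)
      in  extend-by-involution no-partner (∈H·⇒~ y′∈Hy) y′y′≡e
      where
      y≈y⁻¹ : y ≈ y ⁻¹
      y≈y⁻¹ = ≈-inverse-if-no-partner no-partner

  transversal-if-all-covered : ∀ {T} → PartialTransversal T → (∀ g → ¬ Uncovered T g) → CondB G H
  transversal-if-all-covered {T} pt covered = (_∈ T) , transversal , inverse-closed
    where
    open PartialTransversal pt

    transversal : IsRightTransversal G H (_∈ T)
    transversal x = existence , λ t t′ t∈T t∈Hx t′∈T t′∈Hx →
      distinct-cosets t∈T t′∈T (~-trans (~-sym (∈H·⇒~ t∈Hx)) (∈H·⇒~ t′∈Hx))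
      where
      existence : ∃[ t ] (t ∈ T × _∈H·_ G H t x)
      existence with any? (x ~?_) T
      ... | yes x~some = let t , t∈T , x~t = find x~some in t , t∈T , ~⇒∈H· x~t
      ... | no x≁all   = ⊥-elim (covered x (¬Any⇒All¬ T x≁all))

  empty-partial-transversal : PartialTransversal []
  empty-partial-transversal = record
    { inverse-closed  = λ ()
    ; distinct-cosets = λ ()
    ; balanced        = λ d → trans (#uncovered-[] d) (trans (#HdH-⁻¹ d) (sym (#uncovered-[] (d ⁻¹))))
    ; evenly-covered  = λ d _ → inj₂ (0 , sym (trans (+-identityʳ _) (#uncovered-[] d)))
    }
    where
    #uncovered-[] : ∀ d → #uncovered [] d ≡ #HdH d
    #uncovered-[] d = card-cong _ _ (proj₁ , (_, []))

  CondD⇒CondB : CondD G H → CondB G H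
  CondD⇒CondB condD = build _ [] empty-partial-transversal ≤-refl
    where
    build : ∀ n T → PartialTransversal T → #allUncovered T ≤ n → CondB G H
    build n T pt bound with ∃? (uncovered? T)
    ... | no none = transversal-if-all-covered pt (λ g u → none (g , u))
    build zero    T pt bound | yes (y , y-unc) = ⊥-elim (n≮0 (subst (_≤ 0) (card-remove (uncovered? T) y-unc) bound))
    build (suc n) T pt bound | yes (y , y-unc) with extend pt y-unc condD
    ... | T′ , pt′ , smaller = build n T′ pt′ (≤-pred (≤-trans smaller bound))

theorem1p2 : (G : FinGroup) (H : Subgroup G)
    → (CondA G H ⇔ CondB G H) × (CondA G H ⇔ CondC G H) × (CondA G H ⇔ CondD G H)
theorem1p2 G H =
    mk⇔ CondA⇒CondB CondB⇒CondA
  , mk⇔ (CondB⇒CondC ∘ CondA⇒CondB) (CondB⇒CondA ∘ CondD⇒CondB ∘ CondC⇒CondD)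
  , mk⇔ (CondC⇒CondD ∘ CondB⇒CondC ∘ CondA⇒CondB) (CondB⇒CondA ∘ CondD⇒CondB)
  where
  open Conditions G H
  open GreedyTransversal G H
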